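{- Let $G$ be a finite connected simple graph with minimum degree $\delta(G)\ge 2$. Then either $G$ is $2$-connected, or $G$ is an $(H_1,H_2)$-dumbbell for some connected graphs $H_1$ and $H_2$ with $\delta(H_1)\ge 2$ and $\delta(H_2)\ge 2$.
   Context: A path $(v_1,\dots,v_k)$ is a sequence of pairwise distinct vertices with consecutive vertices adjacent; its end-vertices are $v_1,v_k$ and the others are internal. A path in $G$ is binary if all its internal vertices have degree $2$ in $G$. A graph is $2$-connected if it is connected, has at least $3$ vertices, and has no cut vertex. For graphs $H_1,H_2$ (subgraphs of $G$) having at most one vertex in common, $G$ is an $(H_1,H_2)$-dumbbell if $G$ is the union of $H_1$, $H_2$ and a path $P$ such that: (1) $P$ is a binary path in $G$ with $|V(P)|\ge 1$; (2) for each $i\in\{1,2\}$, $V(H_i)\cap V(P)$ consists of exactly one vertex, which is an end-vertex of $P$; (3) if $|V(P)|\ge 2$ then $H_1$ and $H_2$ are vertex disjoint. $\delta(\cdot)$ denotes minimum degree. -}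

module Defs where

open import Data.Nat using (ℕ; _≤_; _+_)
open import Data.Fin using (Fin)
open import Data.Bool using (Bool; true; false; T; if_then_else_; _∧_; not)
open import Data.List using (List; []; _∷_; _++_; allFin; map; head; last; length)
open import Data.Nat.ListAction using (sum)
open import Data.List.Membership.Propositional using (_∈_)
open import Data.List.Relation.Unary.All using (All)
open import Data.List.Relation.Unary.Unique.Propositional using (Unique)
open import Data.List.Relation.Unary.Linked using (Linked)
open import Data.Maybe using (just)
open import Data.Product using (Σ; _×_; ∃; ∃-syntax)
open import Data.Sum using (_⊎_)
open import Relation.Binary.PropositionalEquality using (_≡_; _≢_)
open import Relation.Nullary using (¬_)

record Graph (n : ℕ) : Set where
  field
    adj    : Fin n → Fin n → Bool
    sym    : ∀ x y → adj x y ≡ adj y x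
    irrefl : ∀ x → adj x x ≡ false
open Graph public

record Sub {n : ℕ} (G : Graph n) : Set where
  field
    vs     : Fin n → Bool
    es     : Fin n → Fin n → Bool
    es-sym : ∀ x y → es x y ≡ es y x
    es⊆G   : ∀ x y → T (es x y) → T (adj G x y)
    es-vs  : ∀ x y → T (es x y) → T (vs x)
open Sub public

full : ∀ {n} (G : Graph n) → Sub G
full G = record
  { vs = λ _ → true ; es = adj G ; es-sym = sym G
  ; es⊆G = λ _ _ e → e ; es-vs = λ _ _ _ → _ }

deg : ∀ {n} {G : Graph n} → Sub G → Fin n → ℕ
deg {n} H v = sum (map (λ u → if es H v u then 1 else 0) (allFin n))

MinDeg≥ : ∀ {n} {G : Graph n} → ℕ → Sub G → Set
MinDeg≥ k H = ∀ v → T (vs H v) → k ≤ deg H v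

record PathIn {n : ℕ} {G : Graph n} (H : Sub G) (u w : Fin n) (p : List (Fin n)) : Set where
  field
    distinct : Unique p
    inH      : All (λ x → T (vs H x)) p
    adjacent : Linked (λ x y → T (es H x y)) p
    first    : head p ≡ just u
    final    : last p ≡ just w

Connected : ∀ {n} {G : Graph n} → Sub G → Set
Connected {n} H =
  (∃[ v ] T (vs H v)) ×
  (∀ u w → T (vs H u) → T (vs H w) → ∃[ p ] PathIn H u w p)

delete : ∀ {n} {G : Graph n} → Sub G → Fin n → Sub G
delete {n} {G} H v = record
  { vs = λ x → vs H x ∧ not (x ==v)
  ; es = λ x y → es H x y ∧ not (x ==v) ∧ not (y ==v)
  ; es-sym = λ x y → es-sym' x y
  ; es⊆G = λ x y e → es⊆G H x y (∧-l e)
  ; es-vs = λ x y e → ∧-intro (es-vs H x y (∧-l e)) (∧-l (∧-r {es H x y} e)) }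
  where
  open import Data.Fin using (_≟_)
  open import Relation.Nullary.Decidable using (⌊_⌋)
  open import Data.Bool.Properties using (∧-comm; ∧-assoc)
  open import Relation.Binary.PropositionalEquality using (cong₂; trans; cong)
  _==v : Fin n → Bool
  x ==v = ⌊ x ≟ v ⌋
  ∧-l : ∀ {a b} → T (a ∧ b) → T a
  ∧-l {true} _ = _
  ∧-r : ∀ {a b} → T (a ∧ b) → T b
  ∧-r {true} t = t
  ∧-intro : ∀ {a b} → T a → T b → T (a ∧ b)
  ∧-intro {true} _ t = t
  es-sym' : ∀ x y → (es H x y ∧ not (x ==v) ∧ not (y ==v)) ≡ (es H y x ∧ not (y ==v) ∧ not (x ==v))
  es-sym' x y = cong₂ _∧_ (es-sym H x y) (∧-comm (not (x ==v)) (not (y ==v)))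

-- Vertex count of G is n. 2-connected: connected, at least 3 vertices,
-- no cut vertex (for a connected graph: deleting any vertex leaves it connected).
TwoConnected : ∀ {n} → Graph n → Set
TwoConnected {n} G =
  Connected (full G) × (3 ≤ n) × (∀ v → Connected (delete (full G) v))

Internal : ∀ {n} → List (Fin n) → Fin n → Set
Internal {n} p v = ∃[ a ] ∃[ xs ] ∃[ b ] ∃[ ys ] (p ≡ (a ∷ xs) ++ v ∷ (b ∷ ys))

Binary : ∀ {n} → Graph n → List (Fin n) → Set
Binary G p = ∀ v → Internal p v → deg (full G) v ≡ 2

PEdge : ∀ {n} → List (Fin n) → Fin n → Fin n → Set
PEdge p x y =
  (∃[ xs ] ∃[ ys ] (p ≡ xs ++ x ∷ y ∷ ys)) ⊎ (∃[ xs ] ∃[ ys ] (p ≡ xs ++ y ∷ x ∷ ys))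

Dumbbell : ∀ {n} (G : Graph n) → Sub G → Sub G → Set
Dumbbell {n} G H₁ H₂ =
  (∀ x y → T (vs H₁ x) → T (vs H₂ x) → T (vs H₁ y) → T (vs H₂ y) → x ≡ y) ×
  Σ (Fin n) λ u → Σ (Fin n) λ w → Σ (List (Fin n)) λ P →
    PathIn (full G) u w P ×
    Binary G P ×
    (Σ (Fin n) λ e₁ → ((e₁ ≡ u) ⊎ (e₁ ≡ w)) × (∀ x → (x ∈ P × T (vs H₁ x)) → x ≡ e₁) × (e₁ ∈ P × T (vs H₁ e₁))) ×
    (Σ (Fin n) λ e₂ → ((e₂ ≡ u) ⊎ (e₂ ≡ w)) × (∀ x → (x ∈ P × T (vs H₂ x)) → x ≡ e₂) × (e₂ ∈ P × T (vs H₂ e₂))) ×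
    (2 ≤ length P → ∀ x → T (vs H₁ x) → T (vs H₂ x) → Data.Empty.⊥) ×
    (∀ x → T (vs H₁ x) ⊎ T (vs H₂ x) ⊎ x ∈ P) ×
    (∀ x y → T (adj G x y) → T (es H₁ x y) ⊎ T (es H₂ x y) ⊎ PEdge P x y)
  where import Data.Empty

module Submission where

-- If G − v is connected for every v, then G is 2-connected (δ ≥ 2 forces n ≥ 3). Otherwise
-- G − c splits into two nonempty parts A and B with no edge between them. If c has two
-- neighbours in each part, G[A + c] and G[B + c] form a dumbbell whose path is just c.
-- Otherwise c has a single neighbour a in one part, and ac is a bridge. A bridge st, with s in
-- a vertex set S and t outside it, slides into S while deg s = 2: the other neighbour r of s
-- lies in S and rs is a bridge of S − s. Once deg s ≥ 3, a path is grown from t away from S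
-- through vertices of degree 2 until it reaches a vertex of degree at least 3; the two sides
-- and this path form the dumbbell. Each bell keeps minimum degree 2, because its only vertex
-- that loses edges is its attaching vertex, which keeps at least two.

open import Defs hiding (sym)
open import Data.Nat using (ℕ; zero; suc; _+_; _*_; _≤_; _<_; z≤n; s≤s; _≤?_)
open import Data.Nat.Properties
  using ( ≤-refl; ≤-trans; <-≤-trans; ≤-pred; ≤-antisym; ≰⇒>; <-irrefl; n≤1+n
        ; +-mono-≤; +-mono-<-≤; +-mono-≤-<; *-identityʳ; *-zeroʳ)
open import Data.Nat.ListAction using (sum)
open import Data.Fin using (Fin; zero; suc; _≟_)
open import Data.Fin.Properties using (suc-injective; any?)
open import Data.Bool using (Bool; true; false; T; not; _∧_; _∨_; if_then_else_)
open import Data.Bool.Properties using (T-∧; T-∨; T?)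
open import Data.List using (List; []; _∷_; _++_; map; tabulate; allFin; last)
open import Data.List.Properties using (map-tabulate)
open import Data.List.Membership.Propositional using (_∈_)
open import Data.List.Membership.Propositional.Properties using (∈-∃++; ∈-++⁺ʳ)
open import Data.List.Relation.Unary.All as All using ([]; _∷_)
open import Data.List.Relation.Unary.All.Properties using (¬Any⇒All¬)
open import Data.List.Relation.Unary.AllPairs as AllPairs using ([]; _∷_)
open import Data.List.Relation.Unary.Any as Any using (here; there)
open import Data.List.Relation.Unary.Linked as Linked using (Linked; []; [-]; _∷_)
open import Data.Maybe using (just)
open import Data.Product using (Σ; _×_; _,_; ∃; ∃-syntax; proj₁; proj₂)
open import Data.Sum as Sum using (_⊎_; inj₁; inj₂)
open import Data.Empty using (⊥; ⊥-elim)
open import Function using (_∘_; _⇔_; Equivalence; mk⇔)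
open import Relation.Nullary using (¬_; yes; no)
open import Relation.Nullary.Decidable
  using (⌊_⌋; toWitness; fromWitness; toWitnessFalse; fromWitnessFalse; decidable-stable; toSum)
open import Relation.Binary.PropositionalEquality using (_≡_; _≢_; refl; sym; trans; cong; subst)

private variable
  n : ℕ
  u w x y z : Fin n

open Equivalence using (to; from)

T-not : ∀ {b} → T (not b) ⇔ (¬ T b)
T-not {true}  = mk⇔ (λ ()) (λ ¬t → ¬t _)
T-not {false} = mk⇔ (λ _ ()) _

-- Vertex sets and their sizes

_⊆_ : (A B : Fin n → Bool) → Set
A ⊆ B = ∀ x → T (A x) → T (B x)

_∖_ : (Fin n → Bool) → Fin n → Fin n → Bool
(A ∖ a) x = A x ∧ not ⌊ x ≟ a ⌋

_∪⁅_⁆ : (Fin n → Bool) → Fin n → Fin n → Bool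
(A ∪⁅ a ⁆) x = A x ∨ ⌊ x ≟ a ⌋

∖-⊆ : (A : Fin n → Bool) (a : Fin n) → (A ∖ a) ⊆ A
∖-⊆ A a x t = proj₁ (to T-∧ t)

∖-≢ : (A : Fin n → Bool) {a x : Fin n} → T ((A ∖ a) x) → x ≢ a
∖-≢ A {x = x} A∖a = toWitnessFalse (proj₂ (to (T-∧ {A x}) A∖a))

∖-∌ : (A : Fin n → Bool) (a : Fin n) → ¬ T ((A ∖ a) a)
∖-∌ A a A∖a = ∖-≢ A A∖a refl

∖-intro : (A : Fin n → Bool) {a x : Fin n} → T (A x) → x ≢ a → T ((A ∖ a) x)
∖-intro A Ax x≢a = from T-∧ (Ax , fromWitnessFalse x≢a)

∈-∖-or-≡ : (A : Fin n → Bool) {a x : Fin n} → T (A x) → T ((A ∖ a) x) ⊎ x ≡ a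
∈-∖-or-≡ A {a} {x} Ax with toSum (x ≟ a)
... | inj₁ x≡a = inj₂ x≡a
... | inj₂ x≢a = inj₁ (∖-intro A Ax x≢a)

∖-∌⇒≡ : (A : Fin n → Bool) {a x : Fin n} → T (A x) → ¬ T ((A ∖ a) x) → x ≡ a
∖-∌⇒≡ A {a} {x} Ax x∉A∖a = decidable-stable (x ≟ a) (x∉A∖a ∘ ∖-intro A Ax)

∪⁅⁆-intro : (A : Fin n → Bool) {a x : Fin n} → (x ≢ a → T (A x)) → T ((A ∪⁅ a ⁆) x)
∪⁅⁆-intro A {a} {x} Ax with toSum (x ≟ a)
... | inj₁ x≡a = from (T-∨ {A x}) (inj₂ (fromWitness x≡a))
... | inj₂ x≢a = from T-∨ (inj₁ (Ax x≢a))

∪⁅⁆-elim : (A : Fin n → Bool) {a x : Fin n} → T ((A ∪⁅ a ⁆) x) → x ≢ a → T (A x)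
∪⁅⁆-elim A {x = x} A+a-x x≢a with to (T-∨ {A x}) A+a-x
... | inj₁ Ax  = Ax
... | inj₂ x≡a = ⊥-elim (x≢a (toWitness x≡a))

⊆-or-witness : (A B : Fin n → Bool) → A ⊆ B ⊎ ∃[ y ] T (A y) × ¬ T (B y)
⊆-or-witness A B with any? (λ y → T? (A y ∧ not (B y)))
... | yes (y , t) = let Ay , ¬By = to T-∧ t in inj₂ (y , Ay , to T-not ¬By)
... | no  none    = inj₁ λ y Ay →
  decidable-stable (T? (B y)) λ ¬By → none (y , from T-∧ (Ay , from T-not ¬By))

all⊎any : {P Q : Fin n → Set} → (∀ x → P x ⊎ Q x) → (∀ x → P x) ⊎ ∃ Q
all⊎any {zero}  _ = inj₁ λ ()
all⊎any {suc n} f with f zero | all⊎any (f ∘ suc)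
... | inj₂ q₀ | _            = inj₂ (zero , q₀)
... | inj₁ _  | inj₂ (x , q) = inj₂ (suc x , q)
... | inj₁ p₀ | inj₁ p       = inj₁ λ { zero → p₀ ; (suc x) → p x }

indicator : Bool → ℕ
indicator b = if b then 1 else 0

-- Defined so that deg H v is definitionally count (es H v).
count : (Fin n → Bool) → ℕ
count {n} A = sum (map (indicator ∘ A) (allFin n))

count-suc : (A : Fin (suc n) → Bool) → count A ≡ indicator (A zero) + count (A ∘ suc)
count-suc {n} A = cong (λ xs → indicator (A zero) + sum xs)
  (trans (map-tabulate suc (indicator ∘ A)) (sym (map-tabulate (λ i → i) (indicator ∘ A ∘ suc))))

indicator-mono : ∀ {a b} → (T a → T b) → indicator a ≤ indicator b
indicator-mono {false}          _   = z≤n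
indicator-mono {true}  {true}   _   = ≤-refl
indicator-mono {true}  {false} a⇒b = ⊥-elim (a⇒b _)

indicator-< : ∀ {a b} → T b → ¬ T a → indicator a < indicator b
indicator-< {false} {true} _ _  = s≤s z≤n
indicator-< {true}         _ ¬a = ⊥-elim (¬a _)

count-mono : (A B : Fin n → Bool) → A ⊆ B → count A ≤ count B
count-mono {zero}  A B A⊆B = z≤n
count-mono {suc n} A B A⊆B rewrite count-suc A | count-suc B =
  +-mono-≤ (indicator-mono (A⊆B zero)) (count-mono (A ∘ suc) (B ∘ suc) (A⊆B ∘ suc))

count-< : (A B : Fin n → Bool) → A ⊆ B → ∀ y → T (B y) → ¬ T (A y) → count A < count B
count-< {suc n} A B A⊆B y By ¬Ay rewrite count-suc A | count-suc B with y
... | zero  = +-mono-<-≤ (indicator-< By ¬Ay) (count-mono (A ∘ suc) (B ∘ suc) (A⊆B ∘ suc))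
... | suc y = +-mono-≤-< (indicator-mono (A⊆B zero)) (count-< (A ∘ suc) (B ∘ suc) (A⊆B ∘ suc) y By ¬Ay)

count-const : ∀ n b → count {n} (λ _ → b) ≡ n * indicator b
count-const zero    b = refl
count-const (suc n) b = trans (count-suc {n} (λ _ → b)) (cong (indicator b +_) (count-const n b))

count≤n : (A : Fin n → Bool) → count A ≤ n
count≤n {n} A = subst (count A ≤_) (trans (count-const n true) (*-identityʳ n)) (count-mono A _ λ _ _ → _)

count<n : (A : Fin n → Bool) → ∀ y → ¬ T (A y) → count A < n
count<n {n} A y ¬Ay =
  subst (count A <_) (trans (count-const n true) (*-identityʳ n)) (count-< A _ (λ _ _ → _) y _ ¬Ay)

∈⇒count>0 : (A : Fin n → Bool) → ∀ y → T (A y) → 0 < count A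
∈⇒count>0 {n} A y Ay =
  subst (_< count A) (trans (count-const n false) (*-zeroʳ n)) (count-< _ A (λ _ ()) y Ay λ ())

count>0⇒∈ : (A : Fin n → Bool) → 0 < count A → ∃[ y ] T (A y)
count>0⇒∈ {suc n} A pos rewrite count-suc A with A zero in eq
... | true  = zero , subst T (sym eq) _
... | false = let y , Ay = count>0⇒∈ (A ∘ suc) pos in suc y , Ay

∖-suc : (A : Fin (suc n) → Bool) (a : Fin n) → ((A ∘ suc) ∖ a) ⊆ ((A ∖ suc a) ∘ suc)
∖-suc A a x A∖a = ∖-intro A (∖-⊆ (A ∘ suc) a x A∖a) (∖-≢ (A ∘ suc) A∖a ∘ suc-injective)

count-∖ : (A : Fin n → Bool) (a : Fin n) → count A ≤ suc (count (A ∖ a))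
count-∖ {suc n} A zero rewrite count-suc A | count-suc (A ∖ zero) with A zero
... | true  = s≤s (count-mono (A ∘ suc) _ λ _ Ax → ∖-intro A {zero} Ax λ ())
... | false = ≤-trans (count-mono (A ∘ suc) _ λ _ Ax → ∖-intro A {zero} Ax λ ()) (n≤1+n _)
count-∖ {suc n} A (suc a) rewrite count-suc A | count-suc (A ∖ suc a) with A zero
... | true  = s≤s (≤-trans (count-∖ (A ∘ suc) a) (s≤s (count-mono _ _ (∖-suc A a))))
... | false = ≤-trans (count-∖ (A ∘ suc) a) (s≤s (count-mono _ _ (∖-suc A a)))

count-∖-< : (A : Fin n → Bool) → ∀ a → T (A a) → count (A ∖ a) < count A
count-∖-< A a Aa = count-< (A ∖ a) A (∖-⊆ A a) a Aa (∖-∌ A a)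

2≤count : (A : Fin n → Bool) → ∀ {a b} → T (A a) → T (A b) → a ≢ b → 2 ≤ count A
2≤count A {a} {b} Aa Ab a≢b =
  <-≤-trans (s≤s (∈⇒count>0 (A ∖ a) b (∖-intro A Ab (a≢b ∘ sym)))) (count-∖-< A a Aa)

3≤count : (A : Fin n → Bool) → ∀ {a b c} → T (A a) → T (A b) → T (A c) →
          a ≢ b → a ≢ c → b ≢ c → 3 ≤ count A
3≤count A {a} Aa Ab Ac a≢b a≢c b≢c =
  <-≤-trans (s≤s (2≤count (A ∖ a) (∖-intro A Ab (a≢b ∘ sym)) (∖-intro A Ac (a≢c ∘ sym)) b≢c))
            (count-∖-< A a Aa)

2≤count⇒another : (A : Fin n → Bool) → 2 ≤ count A → ∀ a → ∃[ b ] b ≢ a × T (A b)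
2≤count⇒another A 2≤A a =
  let b , A∖a = count>0⇒∈ (A ∖ a) (≤-pred (≤-trans 2≤A (count-∖ A a)))
  in b , ∖-≢ A A∖a , ∖-⊆ A a b A∖a

descent : {A : Set} {P : A → Set} (μ : A → ℕ) → (∀ a → P a ⊎ Σ A λ b → μ b < μ a) → A → Σ A P
descent {A = A} {P} μ step a = go (suc (μ a)) a ≤-refl
  where
  go : ∀ k a → μ a < k → Σ A P
  go zero    _ ()
  go (suc k) a μa<1+k with step a
  ... | inj₁ Pa          = a , Pa
  ... | inj₂ (b , μb<μa) = go k b (<-≤-trans μb<μa (≤-pred μa<1+k))

module Adjacency (G : Graph n) where

  adj-sym : T (adj G x y) → T (adj G y x)
  adj-sym {x} {y} = subst T (Graph.sym G x y)

  adj⇒≢ : T (adj G x y) → x ≢ y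
  adj⇒≢ {x} e refl = subst T (irrefl G x) e

  third-neighbour : ∀ {v a b c} → ¬ 3 ≤ deg (full G) v →
                    T (adj G v a) → T (adj G v b) → T (adj G v c) → a ≢ b → c ≢ a → c ≡ b
  third-neighbour {b = b} {c = c} deg≤2 va vb vc a≢b c≢a = decidable-stable (c ≟ b) λ c≢b →
    deg≤2 (3≤count (adj G _) va vb vc a≢b (c≢a ∘ sym) (c≢b ∘ sym))

-- Walks and paths

module _ {G : Graph n} (H : Sub G) where

  data Walk : Fin n → Fin n → Set where
    []  : Walk u u
    _∷_ : T (es H u x) → Walk x w → Walk u w

  es-flip : T (es H x y) → T (es H y x)
  es-flip {x} {y} = subst T (es-sym H x y)

  es-vsʳ : T (es H x y) → T (vs H y)
  es-vsʳ {x} {y} e = es-vs H y x (es-flip e)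

module _ {G : Graph n} {H : Sub G} where

  _++ʷ_ : Walk H u x → Walk H x w → Walk H u w
  []      ++ʷ q = q
  (e ∷ p) ++ʷ q = e ∷ (p ++ʷ q)

  reverseʷ : Walk H u w → Walk H w u
  reverseʷ []      = []
  reverseʷ (e ∷ p) = reverseʷ p ++ʷ (es-flip H e ∷ [])

  Walk-vs : Walk H u w → T (vs H u) → T (vs H w)
  Walk-vs []      Hu = Hu
  Walk-vs (e ∷ p) _  = Walk-vs p (es-vsʳ H e)

  PathIn-∷ : ∀ {p} → T (es H u x) → ¬ u ∈ p → PathIn H x w p → PathIn H u w (u ∷ p)
  PathIn-∷ {p = []}    _ _   path with () ← PathIn.first path
  PathIn-∷ {p = _ ∷ _} e u∉p path with refl ← PathIn.first path = record
    { distinct = ¬Any⇒All¬ _ u∉p ∷ distinct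
    ; inH      = es-vs H _ _ e ∷ inH
    ; adjacent = e ∷ adjacent
    ; first    = refl
    ; final    = final }
    where open PathIn path

  PathIn-tail : ∀ {zs} → PathIn H u w (y ∷ z ∷ zs) → PathIn H z w (z ∷ zs)
  PathIn-tail path = record
    { distinct = AllPairs.tail distinct
    ; inH      = All.tail inH
    ; adjacent = Linked.tail adjacent
    ; first    = refl
    ; final    = final }
    where open PathIn path

  PathIn-suffix : ∀ pre {suf} → PathIn H u w (pre ++ x ∷ suf) → PathIn H x w (x ∷ suf)
  PathIn-suffix []            path = record
    { distinct = distinct ; inH = inH ; adjacent = adjacent ; first = refl ; final = final }
    where open PathIn path
  PathIn-suffix (_ ∷ [])      path = PathIn-tail path
  PathIn-suffix (_ ∷ z ∷ pre) path = PathIn-suffix (z ∷ pre) (PathIn-tail path)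

  PathIn-vertex : T (vs H u) → PathIn H u u (u ∷ [])
  PathIn-vertex Hu = record { distinct = [] ∷ [] ; inH = Hu ∷ [] ; adjacent = [-] ; first = refl ; final = refl }

  walk⇒path : Walk H u w → T (vs H u) → ∃ (PathIn H u w)
  walk⇒path {u} [] Hu = u ∷ [] , PathIn-vertex Hu
  walk⇒path {u} (e ∷ p) _ with walk⇒path p (es-vsʳ H e)
  ... | q , path with Any.any? (u ≟_) q
  ...   | no  u∉q = u ∷ q , PathIn-∷ e u∉q path
  ...   | yes u∈q with pre , suf , refl ← ∈-∃++ u∈q = u ∷ suf , PathIn-suffix pre path

  Linked⇒Walk : ∀ p → Linked (λ x y → T (es H x y)) (u ∷ p) → last (u ∷ p) ≡ just w → Walk H u w
  Linked⇒Walk []      _       refl = []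
  Linked⇒Walk (_ ∷ p) (e ∷ k) l    = e ∷ Linked⇒Walk p k l

  path⇒walk : ∀ {p} → PathIn H u w p → Walk H u w
  path⇒walk {p = []}    path with () ← PathIn.first path
  path⇒walk {p = _ ∷ p} path with refl ← PathIn.first path =
    Linked⇒Walk p (PathIn.adjacent path) (PathIn.final path)

module _ (G : Graph n) where

  Binary-vertex : ∀ a → Binary G (a ∷ [])
  Binary-vertex _ _ (_ , []    , _ , _ , ())
  Binary-vertex _ _ (_ , _ ∷ _ , _ , _ , ())

  Binary-edge : ∀ a b → Binary G (a ∷ b ∷ [])
  Binary-edge _ _ _ (_ , []        , _ , _ , ())
  Binary-edge _ _ _ (_ , _ ∷ []    , _ , _ , ())
  Binary-edge _ _ _ (_ , _ ∷ _ ∷ _ , _ , _ , ())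

  Binary-∷ : ∀ {r t ps} → deg (full G) t ≡ 2 → Binary G (t ∷ ps) → Binary G (r ∷ t ∷ ps)
  Binary-∷ deg≡2 _      _ (_ , []     , _ , _ , refl) = deg≡2
  Binary-∷ _     binary v (_ , x ∷ xs , b , ys , refl) = binary v (x , xs , b , ys , refl)

PEdge-∷ : ∀ {r : Fin n} {p} → PEdge p x y → PEdge (r ∷ p) x y
PEdge-∷ {r = r} (inj₁ (xs , ys , eq)) = inj₁ (r ∷ xs , ys , cong (r ∷_) eq)
PEdge-∷ {r = r} (inj₂ (xs , ys , eq)) = inj₂ (r ∷ xs , ys , cong (r ∷_) eq)

PEdge⇒∈ : ∀ {p} → PEdge p x y → x ∈ p
PEdge⇒∈ (inj₁ (xs , _ , refl)) = ∈-++⁺ʳ xs (here refl)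
PEdge⇒∈ (inj₂ (xs , _ , refl)) = ∈-++⁺ʳ xs (there (here refl))

-- Induced subgraphs

module _ (G : Graph n) where

  induced : (Fin n → Bool) → Sub G
  induced S = record
    { vs     = S
    ; es     = λ x y → S x ∧ S y ∧ adj G x y
    ; es-sym = es-sym′
    ; es⊆G   = λ x y e → proj₂ (to T-∧ (proj₂ (to (T-∧ {S x}) e)))
    ; es-vs  = λ x y e → proj₁ (to T-∧ e) }
    where
    es-sym′ : ∀ x y → (S x ∧ S y ∧ adj G x y) ≡ (S y ∧ S x ∧ adj G y x)
    es-sym′ x y with S x | S y
    ... | true  | true  = Graph.sym G x y
    ... | true  | false = refl
    ... | false | true  = refl
    ... | false | false = refl

  induced-edge : ∀ S → T (S x) → T (S y) → T (adj G x y) → T (es (induced S) x y)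
  induced-edge S Sx Sy e = from T-∧ (Sx , from T-∧ (Sy , e))

  ClosedExcept : (Fin n → Bool) → Fin n → Set
  ClosedExcept S z = ∀ {u w} → T (S u) → u ≢ z → T (adj G u w) → T (S w)

  Connected⇒Walk : Connected (full G) → ∀ u w → Walk (full G) u w
  Connected⇒Walk (_ , conn) u w = path⇒walk (proj₂ (conn u w _ _))

  module _ {S : Fin n → Bool} {z : Fin n} (Sz : T (S z)) (closed : ClosedExcept S z) where

    walk-into : Walk (full G) u z → T (S u) → Walk (induced S) u z
    walk-into [] _ = []
    walk-into {u} (e ∷ walk) Su with u ≟ z
    ... | yes refl = []
    ... | no  u≢z  = induced-edge S Su (closed Su u≢z e) e ∷ walk-into walk (closed Su u≢z e)

    induced-connected : Connected (full G) → Connected (induced S)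
    induced-connected conn = (z , Sz) , λ u w Su Sw →
      walk⇒path (walk-into (Connected⇒Walk conn u z) Su ++ʷ
                 reverseʷ (walk-into (Connected⇒Walk conn w z) Sw)) Su

  deg-induced-≥ : ∀ S {v} → T (S v) → (∀ {w} → T (adj G v w) → T (S w)) →
                  deg (full G) v ≤ deg (induced S) v
  deg-induced-≥ S {v} Sv nbrs∈S = count-mono (adj G v) _ λ w e → induced-edge S Sv (nbrs∈S e) e

  deg-induced-≥-1 : ∀ S {v p} → T (S v) → (∀ {w} → T (adj G v w) → ¬ T (S w) → w ≡ p) →
                    deg (full G) v ≤ suc (deg (induced S) v)
  deg-induced-≥-1 S {v} {p} Sv exit =
    ≤-trans (count-∖ (adj G v) p) (s≤s (count-mono (adj G v ∖ p) _ nbr∈S))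
    where
    nbr∈S : (adj G v ∖ p) ⊆ es (induced S) v
    nbr∈S w v~w∖p = let v~w = ∖-⊆ (adj G v) p w v~w∖p in
      induced-edge S Sv (decidable-stable (T? (S w)) (∖-≢ (adj G v) v~w∖p ∘ exit v~w)) v~w

  ClosedExcept⇒MinDeg≥2 : MinDeg≥ 2 (full G) → ∀ {S z} → ClosedExcept S z → 2 ≤ deg (induced S) z →
                          MinDeg≥ 2 (induced S)
  ClosedExcept⇒MinDeg≥2 δ≥2 {S} {z} closed 2≤deg-z v Sv with v ≟ z
  ... | yes refl = 2≤deg-z
  ... | no  v≢z  = ≤-trans (δ≥2 v _) (deg-induced-≥ S Sv (closed Sv v≢z))

module _ (G : Graph n) where

  delete-vs : x ≢ y → T (vs (delete (full G) y) x)
  delete-vs = fromWitnessFalse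

  delete-vs⁻ : T (vs (delete (full G) y) x) → x ≢ y
  delete-vs⁻ = toWitnessFalse

  delete-es : T (adj G x y) → x ≢ z → y ≢ z → T (es (delete (full G) z) x y)
  delete-es e x≢z y≢z = from T-∧ (e , from T-∧ (delete-vs x≢z , delete-vs y≢z))

-- Connectivity via reachable sets

module Reachability {G : Graph n} (H : Sub G) (s : Fin n) where

  step : (Fin n → Bool) → Fin n → Bool
  step A y = A y ∨ ⌊ any? (λ x → T? (A x ∧ es H x y)) ⌋

  ⊆-step : ∀ A → A ⊆ step A
  ⊆-step A y Ay = from T-∨ (inj₁ Ay)

  step-edge : ∀ A → T (A x) → T (es H x y) → T (step A y)
  step-edge {x = x} {y = y} A Ax e = from (T-∨ {A y}) (inj₂ (fromWitness (x , from T-∧ (Ax , e))))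

  step-cases : ∀ A → T (step A y) → T (A y) ⊎ ∃[ x ] T (A x) × T (es H x y)
  step-cases {y = y} A t with to (T-∨ {A y}) t
  ... | inj₁ Ay = inj₁ Ay
  ... | inj₂ ex = let x , e = toWitness ex in inj₂ (x , to T-∧ e)

  step-mono : ∀ A B → A ⊆ B → step A ⊆ step B
  step-mono A B A⊆B y t with step-cases A t
  ... | inj₁ Ay           = ⊆-step B y (A⊆B y Ay)
  ... | inj₂ (x , Ax , e) = step-edge B (A⊆B x Ax) e

  reach : ℕ → Fin n → Bool
  reach zero    y = ⌊ y ≟ s ⌋
  reach (suc k)   = step (reach k)

  reach-∋ : ∀ k → T (reach k s)
  reach-∋ zero    = fromWitness refl
  reach-∋ (suc k) = ⊆-step (reach k) s (reach-∋ k)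

  reach⇒Walk : ∀ k → T (reach k y) → Walk H s y
  reach⇒Walk zero    t with refl ← toWitness t = []
  reach⇒Walk (suc k) t with step-cases (reach k) t
  ... | inj₁ r           = reach⇒Walk k r
  ... | inj₂ (x , r , e) = reach⇒Walk k r ++ʷ (e ∷ [])

  reach-stable-or-grows : ∀ k → step (reach k) ⊆ reach k ⊎ k < count (reach k)
  reach-stable-or-grows zero = inj₂ (∈⇒count>0 (reach zero) s (reach-∋ zero))
  reach-stable-or-grows (suc k) with reach-stable-or-grows k
  ... | inj₁ stable = inj₁ (step-mono _ _ stable)
  ... | inj₂ k<|R| with ⊆-or-witness (step (reach k)) (reach k)
  ...   | inj₁ stable          = inj₁ (step-mono _ _ stable)
  ...   | inj₂ (y , new , old) = inj₂ (≤-trans (s≤s k<|R|) (count-< _ _ (⊆-step (reach k)) y new old))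

  Reach : Fin n → Bool
  Reach = reach n

  -- Were reach still growing at step n, it would have more than n elements.
  Reach-closed : T (Reach x) → T (es H x y) → T (Reach y)
  Reach-closed {y = y} Rx e with reach-stable-or-grows n
  ... | inj₁ stable = stable y (step-edge Reach Rx e)
  ... | inj₂ n<|R| = ⊥-elim (<-irrefl refl (<-≤-trans n<|R| (count≤n Reach)))

record Separation {G : Graph n} (H : Sub G) : Set where
  field
    part      : Fin n → Bool
    part⊆     : part ⊆ vs H
    closed    : T (part x) → T (es H x y) → T (part y)
    inside    : Fin n
    inside∈   : T (part inside)
    outside   : Fin n
    outside∈H : T (vs H outside)
    outside∉  : ¬ T (part outside)

connected-or-separated : {G : Graph n} (H : Sub G) {s : Fin n} → T (vs H s) → Connected H ⊎ Separation H
connected-or-separated {n} H {s} Hs = decide (⊆-or-witness (vs H) Reach)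
  where
  open Reachability H s
  decide : vs H ⊆ Reach ⊎ ∃[ b ] T (vs H b) × ¬ T (Reach b) → Connected H ⊎ Separation H
  decide (inj₁ H⊆R) = inj₁ ((s , Hs) , λ u w Hu Hw →
    walk⇒path (reverseʷ (reach⇒Walk n (H⊆R u Hu)) ++ʷ reach⇒Walk n (H⊆R w Hw)) Hu)
  decide (inj₂ (b , Hb , b∉R)) = inj₂ record
    { part = Reach ; part⊆ = λ x Rx → Walk-vs (reach⇒Walk n Rx) Hs ; closed = Reach-closed
    ; inside = s ; inside∈ = reach-∋ n ; outside = b ; outside∈H = Hb ; outside∉ = b∉R }

-- Dumbbells

HasDumbbell : Graph n → Set
HasDumbbell G = Σ (Sub G) λ H₁ → Σ (Sub G) λ H₂ →
  Connected H₁ × Connected H₂ × MinDeg≥ 2 H₁ × MinDeg≥ 2 H₂ × Dumbbell G H₁ H₂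

module Decomposition (G : Graph n) (conn : Connected (full G)) (δ≥2 : MinDeg≥ 2 (full G)) where

  open Adjacency G

  degree : Fin n → ℕ
  degree = deg (full G)

  bell : ∀ {S z} → T (S z) → ClosedExcept G S z → 2 ≤ deg (induced G S) z →
         Connected (induced G S) × MinDeg≥ 2 (induced G S)
  bell Sz closed 2≤deg = induced-connected G Sz closed conn , ClosedExcept⇒MinDeg≥2 G δ≥2 closed 2≤deg

  record Bridge : Set where
    field
      S    : Fin n → Bool
      s t  : Fin n
      s∈S  : T (S s)
      t∉S  : ¬ T (S t)
      s~t  : T (adj G s t)
      only : ∀ {u w} → T (S u) → ¬ T (S w) → T (adj G u w) → u ≡ s × w ≡ t

  module Slide (b : Bridge) (deg-s≤2 : ¬ 3 ≤ degree (Bridge.s b)) where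
    open Bridge b

    private
      other : ∃[ r ] r ≢ t × T (adj G s r)
      other = 2≤count⇒another (adj G s) (δ≥2 s _) t

      r : Fin n
      r = proj₁ other

      r≢t : r ≢ t
      r≢t = proj₁ (proj₂ other)

      s~r : T (adj G s r)
      s~r = proj₂ (proj₂ other)

      r∈S : T (S r)
      r∈S = decidable-stable (T? (S r)) λ r∉S → r≢t (proj₂ (only s∈S r∉S s~r))

      only′ : ∀ {u w} → T ((S ∖ s) u) → ¬ T ((S ∖ s) w) → T (adj G u w) → u ≡ r × w ≡ s
      only′ {u} {w} u∈S′ w∉S′ u~w = u≡r , w≡s
        where
        u∈S : T (S u)
        u∈S = ∖-⊆ S s u u∈S′
        u≢s : u ≢ s
        u≢s = ∖-≢ S u∈S′
        w∈S : T (S w)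
        w∈S = decidable-stable (T? (S w)) λ w∉S → u≢s (proj₁ (only u∈S w∉S u~w))
        w≡s : w ≡ s
        w≡s = ∖-∌⇒≡ S w∈S w∉S′
        u≡r : u ≡ r
        u≡r = third-neighbour deg-s≤2 s~t s~r (subst (λ v → T (adj G v u)) w≡s (adj-sym u~w))
                (r≢t ∘ sym) λ u≡t → t∉S (subst (T ∘ S) u≡t u∈S)

    slid : Bridge
    slid = record
      { S = S ∖ s ; s = r ; t = s ; s∈S = ∖-intro S r∈S (adj⇒≢ s~r ∘ sym) ; t∉S = ∖-∌ S s
      ; s~t = adj-sym s~r ; only = only′ }

  slide : (b : Bridge) →
          3 ≤ degree (Bridge.s b) ⊎ Σ Bridge λ b′ → count (Bridge.S b′) < count (Bridge.S b)
  slide b with 3 ≤? degree (Bridge.s b)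
  ... | yes 3≤deg = inj₁ 3≤deg
  ... | no  deg≤2 = inj₂ (Slide.slid b deg≤2 , count-∖-< S s s∈S)
    where open Bridge b

  -- Y, S and the path t ∷ Ps cover G as in a dumbbell; it is one once deg t ≥ 3, because
  -- q, the successor of t on the path, is the only neighbour of t outside Y.
  record PartialDumbbell : Set where
    field
      S Y      : Fin n → Bool
      s t q    : Fin n
      Ps       : List (Fin n)
      path     : PathIn (full G) t s (t ∷ Ps)
      binary   : Binary G (t ∷ Ps)
      s∈S      : T (S s)
      t∈Y      : T (Y t)
      disjoint : ∀ x → T (S x) → T (Y x) → ⊥
      S∩P      : ∀ {x} → x ∈ t ∷ Ps → T (S x) → x ≡ s
      Y∩P      : ∀ {x} → x ∈ t ∷ Ps → T (Y x) → x ≡ t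
      s∈P      : s ∈ t ∷ Ps
      cover    : ∀ x → T (S x) ⊎ T (Y x) ⊎ x ∈ t ∷ Ps
      edges    : ∀ {x y} → T (adj G x y) → (T (S x) × T (S y)) ⊎ (T (Y x) × T (Y y)) ⊎ PEdge (t ∷ Ps) x y
      S-deg    : 2 ≤ deg (induced G S) s
      t~q      : T (adj G t q)
      q∈P      : q ∈ t ∷ Ps
      q≢t      : q ≢ t
      t-exit   : ∀ {w} → T (adj G t w) → ¬ T (Y w) → w ≡ q

  start : (b : Bridge) → 3 ≤ degree (Bridge.s b) → PartialDumbbell
  start b 3≤deg = record
    { S = S ; Y = not ∘ S ; s = s ; t = t ; q = s ; Ps = s ∷ []
    ; path = PathIn-∷ (adj-sym s~t) (λ { (here t≡s) → s≢t (sym t≡s) }) (PathIn-vertex _)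
    ; binary = Binary-edge G t s
    ; s∈S = s∈S ; t∈Y = from T-not t∉S
    ; disjoint = λ x Sx ¬Sx → to T-not ¬Sx Sx
    ; S∩P = λ { (here refl) St → ⊥-elim (t∉S St) ; (there (here refl)) _ → refl }
    ; Y∩P = λ { (here refl) _ → refl ; (there (here refl)) ¬Ss → ⊥-elim (to T-not ¬Ss s∈S) }
    ; s∈P = there (here refl)
    ; cover = cover′
    ; edges = edges′
    ; S-deg = ≤-pred (≤-trans 3≤deg (deg-induced-≥-1 G S s∈S λ e w∉S → proj₂ (only s∈S w∉S e)))
    ; t~q = adj-sym s~t ; q∈P = there (here refl) ; q≢t = s≢t
    ; t-exit = λ {w} t~w w∉Y →
        proj₁ (only (decidable-stable (T? (S w)) (w∉Y ∘ from T-not)) t∉S (adj-sym t~w)) }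
    where
    open Bridge b
    s≢t : s ≢ t
    s≢t = adj⇒≢ s~t
    cover′ : ∀ x → T (S x) ⊎ T (not (S x)) ⊎ x ∈ t ∷ s ∷ []
    cover′ x with T? (S x)
    ... | yes Sx = inj₁ Sx
    ... | no ¬Sx = inj₂ (inj₁ (from T-not ¬Sx))
    edges′ : ∀ {x y} → T (adj G x y) →
             (T (S x) × T (S y)) ⊎ (T (not (S x)) × T (not (S y))) ⊎ PEdge (t ∷ s ∷ []) x y
    edges′ {x} {y} e with T? (S x) | T? (S y)
    ... | yes Sx | yes Sy = inj₁ (Sx , Sy)
    ... | no ¬Sx | no ¬Sy = inj₂ (inj₁ (from T-not ¬Sx , from T-not ¬Sy))
    ... | yes Sx | no ¬Sy with refl , refl ← only Sx ¬Sy e = inj₂ (inj₂ (inj₂ ([] , [] , refl)))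
    ... | no ¬Sx | yes Sy with refl , refl ← only Sy ¬Sx (adj-sym e) = inj₂ (inj₂ (inj₁ ([] , [] , refl)))

  module Extend (d : PartialDumbbell) (deg-t≤2 : ¬ 3 ≤ degree (PartialDumbbell.t d)) where
    open PartialDumbbell d

    private
      other : ∃[ r ] r ≢ q × T (adj G t r)
      other = 2≤count⇒another (adj G t) (δ≥2 t _) q

      r : Fin n
      r = proj₁ other

      r≢q : r ≢ q
      r≢q = proj₁ (proj₂ other)

      t~r : T (adj G t r)
      t~r = proj₂ (proj₂ other)

      r≢t : r ≢ t
      r≢t = adj⇒≢ t~r ∘ sym

      r∈Y : T (Y r)
      r∈Y = decidable-stable (T? (Y r)) (r≢q ∘ t-exit t~r)

      r∉P : ¬ r ∈ t ∷ Ps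
      r∉P r∈P = r≢t (Y∩P r∈P r∈Y)

      degree-t≡2 : degree t ≡ 2
      degree-t≡2 = ≤-antisym (≤-pred (≰⇒> deg-t≤2)) (δ≥2 t _)

      Y-neighbour : ∀ {y} → T (adj G t y) → T (Y y) → y ≡ r
      Y-neighbour t~y y∈Y = third-neighbour deg-t≤2 t~q t~r t~y (r≢q ∘ sym)
        λ y≡q → q≢t (Y∩P q∈P (subst (T ∘ Y) y≡q y∈Y))

      Y′ : Fin n → Bool
      Y′ = Y ∖ t

      cover′ : ∀ x → T (S x) ⊎ T (Y′ x) ⊎ x ∈ r ∷ t ∷ Ps
      cover′ x with cover x
      ... | inj₁ Sx        = inj₁ Sx
      ... | inj₂ (inj₂ x∈P) = inj₂ (inj₂ (there x∈P))
      ... | inj₂ (inj₁ Yx) with ∈-∖-or-≡ Y Yx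
      ...   | inj₁ Y′x = inj₂ (inj₁ Y′x)
      ...   | inj₂ x≡t = inj₂ (inj₂ (there (here x≡t)))

      edges′ : ∀ {x y} → T (adj G x y) →
               (T (S x) × T (S y)) ⊎ (T (Y′ x) × T (Y′ y)) ⊎ PEdge (r ∷ t ∷ Ps) x y
      edges′ {x} {y} e with edges e
      ... | inj₁ Sxy       = inj₁ Sxy
      ... | inj₂ (inj₂ pe) = inj₂ (inj₂ (PEdge-∷ pe))
      ... | inj₂ (inj₁ (Yx , Yy)) with ∈-∖-or-≡ Y Yx | ∈-∖-or-≡ Y Yy
      ...   | inj₁ Y′x | inj₁ Y′y = inj₂ (inj₁ (Y′x , Y′y))
      ...   | inj₂ refl | _ with refl ← Y-neighbour e Yy = inj₂ (inj₂ (inj₂ ([] , Ps , refl)))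
      ...   | inj₁ _ | inj₂ refl with refl ← Y-neighbour (adj-sym e) Yx =
        inj₂ (inj₂ (inj₁ ([] , Ps , refl)))

      r-exit : ∀ {w} → T (adj G r w) → ¬ T (Y′ w) → w ≡ t
      r-exit {w} r~w w∉Y′ with T? (Y w) | edges r~w
      ... | yes w∈Y | _                    = ∖-∌⇒≡ Y w∈Y w∉Y′
      ... | no  _   | inj₁ (r∈S , _)        = ⊥-elim (disjoint r r∈S r∈Y)
      ... | no  w∉Y | inj₂ (inj₁ (_ , w∈Y)) = ⊥-elim (w∉Y w∈Y)
      ... | no  _   | inj₂ (inj₂ pe)        = ⊥-elim (r∉P (PEdge⇒∈ pe))

    extended : PartialDumbbell
    extended = record
      { S = S ; Y = Y′ ; s = s ; t = r ; q = t ; Ps = t ∷ Ps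
      ; path = PathIn-∷ (adj-sym t~r) r∉P path
      ; binary = Binary-∷ G degree-t≡2 binary
      ; s∈S = s∈S ; t∈Y = ∖-intro Y r∈Y r≢t
      ; disjoint = λ x Sx Y′x → disjoint x Sx (∖-⊆ Y t x Y′x)
      ; S∩P = λ { (here refl) r∈S → ⊥-elim (disjoint r r∈S r∈Y) ; (there x∈P) → S∩P x∈P }
      ; Y∩P = λ { (here refl) _ → refl
                ; (there x∈P) Y′x → ⊥-elim (∖-≢ Y Y′x (Y∩P x∈P (∖-⊆ Y t _ Y′x))) }
      ; s∈P = there s∈P
      ; cover = cover′
      ; edges = edges′
      ; S-deg = S-deg
      ; t~q = adj-sym t~r ; q∈P = there (here refl) ; q≢t = r≢t ∘ sym ; t-exit = r-exit }

  extend : (d : PartialDumbbell) → 3 ≤ degree (PartialDumbbell.t d) ⊎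
           Σ PartialDumbbell λ d′ → count (PartialDumbbell.Y d′) < count (PartialDumbbell.Y d)
  extend d with 3 ≤? degree (PartialDumbbell.t d)
  ... | yes 3≤deg = inj₁ 3≤deg
  ... | no  deg≤2 = inj₂ (Extend.extended d deg≤2 , count-∖-< Y t t∈Y)
    where open PartialDumbbell d

  complete : (d : PartialDumbbell) → 3 ≤ degree (PartialDumbbell.t d) → HasDumbbell G
  complete d 3≤deg =
    induced G S , induced G Y , proj₁ S-bell , proj₁ Y-bell , proj₂ S-bell , proj₂ Y-bell ,
    (λ x _ Sx Yx _ _ → ⊥-elim (disjoint x Sx Yx)) ,
    t , s , t ∷ Ps , path , binary ,
    (s , inj₂ refl , (λ x (x∈P , Sx) → S∩P x∈P Sx) , s∈P , s∈S) ,
    (t , inj₁ refl , (λ x (x∈P , Yx) → Y∩P x∈P Yx) , here refl , t∈Y) ,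
    (λ _ → disjoint) , cover , induced-edges
    where
    open PartialDumbbell d
    S-closed : ClosedExcept G S s
    S-closed {u} Su u≢s e with edges e
    ... | inj₁ (_ , Sw)        = Sw
    ... | inj₂ (inj₁ (Yu , _)) = ⊥-elim (disjoint u Su Yu)
    ... | inj₂ (inj₂ pe)       = ⊥-elim (u≢s (S∩P (PEdge⇒∈ pe) Su))
    Y-closed : ClosedExcept G Y t
    Y-closed {u} Yu u≢t e with edges e
    ... | inj₁ (Su , _)        = ⊥-elim (disjoint u Su Yu)
    ... | inj₂ (inj₁ (_ , Yw)) = Yw
    ... | inj₂ (inj₂ pe)       = ⊥-elim (u≢t (Y∩P (PEdge⇒∈ pe) Yu))
    S-bell : Connected (induced G S) × MinDeg≥ 2 (induced G S)
    S-bell = bell s∈S S-closed S-deg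
    Y-bell : Connected (induced G Y) × MinDeg≥ 2 (induced G Y)
    Y-bell = bell t∈Y Y-closed (≤-pred (≤-trans 3≤deg (deg-induced-≥-1 G Y t∈Y t-exit)))
    induced-edges : ∀ x y → T (adj G x y) →
                    T (es (induced G S) x y) ⊎ T (es (induced G Y) x y) ⊎ PEdge (t ∷ Ps) x y
    induced-edges x y e with edges e
    ... | inj₁ (Sx , Sy)        = inj₁ (induced-edge G S Sx Sy e)
    ... | inj₂ (inj₁ (Yx , Yy)) = inj₂ (inj₁ (induced-edge G Y Yx Yy e))
    ... | inj₂ (inj₂ pe)        = inj₂ (inj₂ pe)

  bridge⇒dumbbell : Bridge → HasDumbbell G
  bridge⇒dumbbell b =
    let b′ , 3≤deg-s = descent (count ∘ Bridge.S) slide b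
        d  , 3≤deg-t = descent (count ∘ PartialDumbbell.Y) extend (start b′ 3≤deg-s)
    in complete d 3≤deg-t

  -- A union of components of G − c.
  record CutSide (c : Fin n) : Set where
    field
      Z      : Fin n → Bool
      closed : ∀ {u w} → T (Z u) → T (adj G u w) → w ≢ c → T (Z w)
      c∉Z    : ¬ T (Z c)
      z₀     : Fin n
      z₀∈Z   : T (Z z₀)

    Z+c : Fin n → Bool
    Z+c = Z ∪⁅ c ⁆

    Z⊆Z+c : Z ⊆ Z+c
    Z⊆Z+c x Zx = ∪⁅⁆-intro Z λ _ → Zx

    c∈Z+c : T (Z+c c)
    c∈Z+c = ∪⁅⁆-intro Z λ c≢c → ⊥-elim (c≢c refl)

    Z+c-closed : ClosedExcept G Z+c c
    Z+c-closed Z+c-u u≢c e = ∪⁅⁆-intro Z (closed (∪⁅⁆-elim Z Z+c-u u≢c) e)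

    attachments : Fin n → Bool
    attachments w = adj G c w ∧ Z w

    attachment : ∃[ a ] T (adj G c a) × T (Z a)
    attachment = leave (Connected⇒Walk G conn z₀ c) z₀∈Z
      where
      leave : Walk (full G) u c → T (Z u) → ∃[ a ] T (adj G c a) × T (Z a)
      leave []                     Zc = ⊥-elim (c∉Z Zc)
      leave {u} (_∷_ {x = x} e walk) Zu with x ≟ c
      ... | yes refl = u , adj-sym e , Zu
      ... | no  x≢c  = leave walk (closed Zu e x≢c)

    many-attachments⇒deg : 2 ≤ count attachments → 2 ≤ deg (induced G Z+c) c
    many-attachments⇒deg 2≤ = ≤-trans 2≤ (count-mono attachments _ λ w c~w∧Zw →
      let c~w , Zw = to T-∧ c~w∧Zw in induced-edge G Z+c c∈Z+c (Z⊆Z+c w Zw) c~w)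

    few-attachments⇒Bridge : ¬ 2 ≤ count attachments → Bridge
    few-attachments⇒Bridge ≱2 = record
      { S = Z ; s = a ; t = c ; s∈S = Za ; t∉S = c∉Z ; s~t = adj-sym c~a ; only = only }
      where
      a : Fin n
      a = proj₁ attachment
      c~a : T (adj G c a)
      c~a = proj₁ (proj₂ attachment)
      Za : T (Z a)
      Za = proj₂ (proj₂ attachment)
      only : ∀ {u w} → T (Z u) → ¬ T (Z w) → T (adj G u w) → u ≡ a × w ≡ c
      only {u} {w} Zu w∉Z e with w ≟ c
      ... | no  w≢c  = ⊥-elim (w∉Z (closed Zu e w≢c))
      ... | yes refl = decidable-stable (u ≟ a) (λ u≢a →
            ≱2 (2≤count attachments (from T-∧ (c~a , Za)) (from T-∧ (adj-sym e , Zu)) (u≢a ∘ sym))) , refl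

  record Cut (c : Fin n) : Set where
    field
      A B      : CutSide c
      disjoint : ∀ x → T (CutSide.Z A x) → T (CutSide.Z B x) → ⊥
      cover    : ∀ x → x ≢ c → T (CutSide.Z A x) ⊎ T (CutSide.Z B x)

  separation⇒Cut : Separation (delete (full G) z) → Cut z
  separation⇒Cut {z = c} sep = record { A = A ; B = B ; disjoint = disjoint ; cover = cover }
    where
    open Separation sep
    H : Sub G
    H = delete (full G) c
    part⇒≢c : T (part x) → x ≢ c
    part⇒≢c Px = delete-vs⁻ G (part⊆ _ Px)
    rest : Fin n → Bool
    rest x = vs H x ∧ not (part x)
    rest-closed : ∀ {u w} → T (rest u) → T (adj G u w) → w ≢ c → T (rest w)
    rest-closed {u} rest-u e w≢c =
      let Hu , u∉P = to (T-∧ {vs H u}) rest-u in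
      from T-∧ (delete-vs G w≢c , from T-not λ Pw →
        to T-not u∉P (closed Pw (delete-es G (adj-sym e) w≢c (delete-vs⁻ G Hu))))
    A : CutSide c
    A = record
      { Z = part ; closed = λ Pu e w≢c → closed Pu (delete-es G e (part⇒≢c Pu) w≢c)
      ; c∉Z = λ Pc → part⇒≢c Pc refl ; z₀ = inside ; z₀∈Z = inside∈ }
    B : CutSide c
    B = record
      { Z = rest ; closed = rest-closed
      ; c∉Z = λ rest-c → delete-vs⁻ G (proj₁ (to (T-∧ {vs H c}) rest-c)) refl
      ; z₀ = outside ; z₀∈Z = from T-∧ (outside∈H , from T-not outside∉) }
    disjoint : ∀ x → T (part x) → T (rest x) → ⊥
    disjoint x Px rest-x = to T-not (proj₂ (to (T-∧ {vs H x}) rest-x)) Px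
    cover : ∀ x → x ≢ c → T (part x) ⊎ T (rest x)
    cover x x≢c with T? (part x)
    ... | yes Px = inj₁ Px
    ... | no ¬Px = inj₂ (from T-∧ (delete-vs G x≢c , from T-not ¬Px))

  module _ {c : Fin n} (cut : Cut c) where
    open Cut cut
    module A = CutSide A
    module B = CutSide B

    private
      both⇒c : T (A.Z+c x) → T (B.Z+c x) → x ≡ c
      both⇒c {x} Ax Bx = decidable-stable (x ≟ c) λ x≢c →
        disjoint x (∪⁅⁆-elim A.Z Ax x≢c) (∪⁅⁆-elim B.Z Bx x≢c)

      cover⁺ : ∀ x → T (A.Z+c x) ⊎ T (B.Z+c x) ⊎ x ∈ c ∷ []
      cover⁺ x with toSum (x ≟ c)
      ... | inj₁ x≡c = inj₂ (inj₂ (here x≡c))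
      ... | inj₂ x≢c with cover x x≢c
      ...   | inj₁ Ax = inj₁ (A.Z⊆Z+c x Ax)
      ...   | inj₂ Bx = inj₂ (inj₁ (B.Z⊆Z+c x Bx))

      edge-from : x ≢ c → T (adj G x y) → T (es (induced G A.Z+c) x y) ⊎ T (es (induced G B.Z+c) x y)
      edge-from {x} x≢c e with cover x x≢c
      ... | inj₁ Ax = inj₁ (induced-edge G A.Z+c (A.Z⊆Z+c x Ax) (A.Z+c-closed (A.Z⊆Z+c x Ax) x≢c e) e)
      ... | inj₂ Bx = inj₂ (induced-edge G B.Z+c (B.Z⊆Z+c x Bx) (B.Z+c-closed (B.Z⊆Z+c x Bx) x≢c e) e)

      edges⁺ : ∀ x y → T (adj G x y) →
               T (es (induced G A.Z+c) x y) ⊎ T (es (induced G B.Z+c) x y) ⊎ PEdge (c ∷ []) x y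
      edges⁺ x y e with toSum (x ≟ c)
      ... | inj₂ x≢c = Sum.map₂ inj₁ (edge-from x≢c e)
      ... | inj₁ refl = Sum.map (es-flip (induced G A.Z+c)) (inj₁ ∘ es-flip (induced G B.Z+c))
                          (edge-from (adj⇒≢ e ∘ sym) (adj-sym e))

    cut-vertex-dumbbell : 2 ≤ count A.attachments → 2 ≤ count B.attachments → HasDumbbell G
    cut-vertex-dumbbell 2≤A 2≤B =
      induced G A.Z+c , induced G B.Z+c , proj₁ A-bell , proj₁ B-bell , proj₂ A-bell , proj₂ B-bell ,
      (λ x y Ax Bx Ay By → trans (both⇒c Ax Bx) (sym (both⇒c Ay By))) ,
      c , c , c ∷ [] , PathIn-vertex _ , Binary-vertex G c ,
      (c , inj₁ refl , (λ { _ (here refl , _) → refl }) , here refl , A.c∈Z+c) ,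
      (c , inj₁ refl , (λ { _ (here refl , _) → refl }) , here refl , B.c∈Z+c) ,
      (λ { (s≤s ()) }) , cover⁺ , edges⁺
      where
      A-bell : Connected (induced G A.Z+c) × MinDeg≥ 2 (induced G A.Z+c)
      A-bell = bell A.c∈Z+c A.Z+c-closed (A.many-attachments⇒deg 2≤A)
      B-bell : Connected (induced G B.Z+c) × MinDeg≥ 2 (induced G B.Z+c)
      B-bell = bell B.c∈Z+c B.Z+c-closed (B.many-attachments⇒deg 2≤B)

    Cut⇒dumbbell : HasDumbbell G
    Cut⇒dumbbell with 2 ≤? count A.attachments | 2 ≤? count B.attachments
    ... | yes 2≤A | yes 2≤B = cut-vertex-dumbbell 2≤A 2≤B
    ... | no  ≱2  | _       = bridge⇒dumbbell (A.few-attachments⇒Bridge ≱2)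
    ... | yes _   | no  ≱2  = bridge⇒dumbbell (B.few-attachments⇒Bridge ≱2)

  separation-at : ∀ v → Connected (delete (full G) v) ⊎ Separation (delete (full G) v)
  separation-at v = let w , v~w = neighbour in
    connected-or-separated (delete (full G) v) (delete-vs G (adj⇒≢ v~w ∘ sym))
    where
    neighbour : ∃[ w ] T (adj G v w)
    neighbour = count>0⇒∈ (adj G v) (≤-trans (s≤s z≤n) (δ≥2 v _))

  3≤n : 3 ≤ n
  3≤n = let v , _ = proj₁ conn in
    ≤-trans (s≤s (δ≥2 v _)) (count<n (adj G v) v λ v~v → adj⇒≢ v~v refl)

lemma6 : ∀ {n : ℕ} (G : Graph n) →
    Connected (full G) → MinDeg≥ 2 (full G) →
    TwoConnected G ⊎
    Σ (Sub G) λ H₁ → Σ (Sub G) λ H₂ →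
      Connected H₁ × Connected H₂ × MinDeg≥ 2 H₁ × MinDeg≥ 2 H₂ × Dumbbell G H₁ H₂
lemma6 G conn δ≥2 = Sum.map 2-connected dumbbell (all⊎any separation-at)
  where
  open Decomposition G conn δ≥2
  2-connected : (∀ v → Connected (delete (full G) v)) → TwoConnected G
  2-connected G-v-connected = conn , 3≤n , G-v-connected
  dumbbell : ∃[ v ] Separation (delete (full G) v) → HasDumbbell G
  dumbbell (_ , sep) = Cut⇒dumbbell (separation⇒Cut sep)
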